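{- Let $F$ be a perfect field, let $c\in F((t))\setminus F$ and let $N<\omega$. Then there exists an integer $n>1$ such that $\mathrm{Orb}_n(c)\subseteq\{x\in F((t)): v(x-c)>N\}$.
   Context: $v$ is the $t$-adic valuation, $\mathcal{M}=tF[[t]]$. For each uniformiser $s$ (element of value $1$) the map $x\mapsto x\circ s$ (substitution of $s$ for $t$) is an $F$-automorphism of $F((t))$. For $n>1$, $\mathbf{G}_n$ is the group of automorphisms $x\mapsto x\circ s$ with $s\in t+\mathcal{M}^n$, and $\mathrm{Orb}_n(c)=\{\sigma(c):\sigma\in\mathbf{G}_n\}$. -}

module Defs where

open import Level using (Level; _⊔_) renaming (suc to lsuc)
open import Algebra.Bundles using (CommutativeRing)
open import Data.Nat as ℕ using (ℕ; zero; suc; _∸_)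
open import Data.Nat.Primality using (Prime)
open import Data.Integer as ℤ using (ℤ; +_; -[1+_]; _⊓_)
import Data.Integer.Properties as ℤP
open import Data.Product using (Σ; ∃; _×_; _,_)
open import Data.Sum using (_⊎_)
open import Relation.Nullary using (¬_; yes; no)
open import Relation.Nullary.Negation using (contradiction)

record Field (c ℓ : Level) : Set (lsuc (c ⊔ ℓ)) where
  field
    commRing : CommutativeRing c ℓ
  open CommutativeRing commRing public
  field
    1≉0     : ¬ (1# ≈ 0#)
    inverse : ∀ x → ¬ (x ≈ 0#) → ∃ λ y → x * y ≈ 1#

module Over {c ℓ : Level} (F : Field c ℓ) where
  open Field F hiding (zero)

  _·1 : ℕ → Carrier
  zero  ·1 = 0#
  suc n ·1 = 1# + n ·1

  pow : Carrier → ℕ → Carrier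
  pow x zero    = 1#
  pow x (suc n) = x * pow x n

  IsPerfect : Set (c ⊔ ℓ)
  IsPerfect =
    (∀ n → ¬ (suc n ·1 ≈ 0#))
    ⊎ (Σ ℕ λ p → Prime p × (p ·1 ≈ 0#) × (∀ x → ∃ λ y → pow y p ≈ x))

  PS : Set c
  PS = ℕ → Carrier

  sumTo : (ℕ → Carrier) → ℕ → Carrier
  sumTo f zero    = f zero
  sumTo f (suc k) = sumTo f k + f (suc k)

  onePS : PS
  onePS zero    = 1#
  onePS (suc _) = 0#

  mulPS : PS → PS → PS
  mulPS a b k = sumTo (λ j → a j * b (k ∸ j)) k

  powPS : PS → ℕ → PS
  powPS a zero    = onePS
  powPS a (suc i) = mulPS a (powPS a i)

  negPS : PS → PS
  negPS a k = - a k

  onePlus : PS → PS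
  onePlus u zero    = 1# + u zero
  onePlus u (suc k) = u (suc k)

  -- (1 + u)⁻¹ = Σ_j (-u)^j, for u ∈ tF[[t]] (coefficient k only needs j ≤ k)
  invOnePlus : PS → PS
  invOnePlus u k = sumTo (λ j → powPS (negPS u) j k) k

  wPow : PS → ℤ → PS
  wPow u (+ i)     = powPS (onePlus u) i
  wPow u -[1+ i ]  = powPS (invOnePlus u) (suc i)

  shiftPS : ℕ → PS → PS
  shiftPS zero    r j       = r j
  shiftPS (suc k) r zero    = 0#
  shiftPS (suc k) r (suc j) = shiftPS k r j

  record Laurent : Set (c ⊔ ℓ) where
    field
      coeff  : ℤ → Carrier
      low    : ℤ
      vanish : ∀ m → m ℤ.< low → coeff m ≈ 0#
  open Laurent public

  _≈L_ : Laurent → Laurent → Set ℓ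
  x ≈L y = ∀ m → coeff x m ≈ coeff y m

  _-L_ : Laurent → Laurent → Laurent
  x -L y = record
    { coeff  = λ m → coeff x m - coeff y m
    ; low    = low x ⊓ low y
    ; vanish = λ m m<l →
        trans (+-cong (vanish x m (ℤP.<-≤-trans m<l (ℤP.i⊓j≤i (low x) (low y))))
                      (-‿cong (vanish y m (ℤP.<-≤-trans m<l (ℤP.i⊓j≤j (low x) (low y))))))
              (-‿inverseʳ 0#)
    }

  IsConstant : Laurent → Set ℓ
  IsConstant x = ∀ m → ¬ (m ≡ + 0) → coeff x m ≈ 0#
    where open import Relation.Binary.PropositionalEquality using (_≡_)

  -- v(x) > N  (v the t-adic valuation, v(0) = ∞): all coefficients of
  -- index ≤ N vanish.
  ValGt : Laurent → ℕ → Set ℓ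
  ValGt x N = ∀ m → m ℤ.≤ + N → coeff x m ≈ 0#

  -- Substitution x ∘ s for the uniformiser s = t(1 + u), u ∈ tF[[t]]:
  -- x ∘ s = Σ_i x_i s^i = Σ_i x_i t^i (1+u)^i, whose coefficient at t^m is
  -- Σ_{i = low x}^{m} x_i · [t^{m-i}] (1+u)^i.
  compose : Laurent → PS → Laurent
  compose x u = record
    { coeff  = cf
    ; low    = low x
    ; vanish = vn
    }
    where
      cf : ℤ → Carrier
      cf m with m ℤ.<? low x
      ... | yes _ = 0#
      ... | no  _ = let d = ℤ.∣ m ℤ.- low x ∣ in
                    sumTo (λ j → coeff x (low x ℤ.+ + j) * wPow u (low x ℤ.+ + j) (d ∸ j)) d
      vn : ∀ m → m ℤ.< low x → cf m ≈ 0#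
      vn m m<l with m ℤ.<? low x
      ... | yes _  = refl
      ... | no ¬p  = contradiction m<l ¬p

  -- Orb_n(c): images of c under x ↦ x ∘ s with s ∈ t + 𝓜ⁿ,
  -- i.e. s = t + tⁿ r = t(1 + t^{n-1} r) with r ∈ F[[t]].
  InOrb : ℕ → Laurent → Laurent → Set (c ⊔ ℓ)
  InOrb n c x = ∃ λ (r : PS) → x ≈L compose c (shiftPS (n ∸ 1) r)

module Submission where

-- Substitutions close to the identity barely move a Laurent series.
--
-- Write a uniformiser as s = t(1 + u) with u ∈ tF[[t]].  Then
--   c ∘ s = Σ_i c_i t^i (1 + u)^i ,
-- so the coefficient of t^m in c ∘ s is Σ_{i ≥ v(c)} c_i [t^{m-i}] (1 + u)^i.
-- If u ≡ 0 mod t^{K+1}, every power (1 + u)^i, i ∈ ℤ (negative powers via the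
-- geometric series), is ≡ 1 mod t^{K+1}; hence for m ≤ v(c) + K only the term
-- i = m survives and [t^m](c ∘ s) = c_m.  For s ∈ t + 𝓜ⁿ we have u ∈ t^{n-1}F[[t]],
-- so taking n - 2 ≥ N - v(c) gives v(c ∘ s - c) > N.

open import Defs
open import Data.Nat using (ℕ; _<_)
open import Data.Product using (∃; _×_)
open import Relation.Nullary using (¬_)

open import Level using (Level)
open import Data.Nat as ℕ using (zero; suc; _∸_; _≤_; z≤n; s≤s)
import Data.Nat.Properties as ℕP
open import Data.Integer as ℤ using (ℤ; +_; -[1+_])
import Data.Integer.Properties as ℤP
open import Data.Product using (_,_)
open import Relation.Nullary using (yes; no)
open import Relation.Binary.PropositionalEquality as P using (_≡_)
import Algebra.Properties.Ring as RingProperties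

+-minus-cancel : ∀ l m → l ℤ.+ (m ℤ.- l) ≡ m
+-minus-cancel l m = begin
  l ℤ.+ (m ℤ.- l)       ≡⟨ P.cong (λ z → l ℤ.+ z) (ℤP.+-comm m (ℤ.- l)) ⟩
  l ℤ.+ (ℤ.- l ℤ.+ m)   ≡⟨ P.sym (ℤP.+-assoc l (ℤ.- l) m) ⟩
  l ℤ.- l ℤ.+ m         ≡⟨ P.cong (ℤ._+ m) (ℤP.+-inverseʳ l) ⟩
  + 0 ℤ.+ m             ≡⟨ ℤP.+-identityˡ m ⟩
  m                     ∎
  where open P.≡-Reasoning

offset-natural : ∀ {l m} → l ℤ.≤ m → + ℤ.∣ m ℤ.- l ∣ ≡ m ℤ.- l
offset-natural l≤m = ℤP.0≤i⇒+∣i∣≡i (ℤP.i≤j⇒0≤j-i l≤m)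

i≤+∣i∣ : ∀ i → i ℤ.≤ + ℤ.∣ i ∣
i≤+∣i∣ (+ n)     = ℤP.≤-refl
i≤+∣i∣ -[1+ n ]  = ℤ.-≤+

module NearIdentitySubstitution {a ℓ : Level} (F : Field a ℓ) where
  open Field F hiding (zero)
  open Over F
  open RingProperties ring using (-0#≈0#)

  sum-zero : (g : ℕ → Carrier) (k : ℕ) → (∀ j → j ≤ k → g j ≈ 0#) → sumTo g k ≈ 0#
  sum-zero g zero    g≈0 = g≈0 0 z≤n
  sum-zero g (suc k) g≈0 =
    trans (+-cong (sum-zero g k (λ j j≤k → g≈0 j (ℕP.m≤n⇒m≤1+n j≤k))) (g≈0 (suc k) ℕP.≤-refl))
          (+-identityʳ 0#)

  sum-first : (g : ℕ → Carrier) (x : Carrier) (k : ℕ) → g 0 ≈ x →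
              (∀ j → suc j ≤ k → g (suc j) ≈ 0#) → sumTo g k ≈ x
  sum-first g x zero    g0≈x _   = g0≈x
  sum-first g x (suc k) g0≈x g≈0 =
    trans (+-cong (sum-first g x k g0≈x (λ j j<k → g≈0 j (ℕP.m≤n⇒m≤1+n j<k))) (g≈0 k ℕP.≤-refl))
          (+-identityʳ x)

  sum-last : (g : ℕ → Carrier) (x : Carrier) (k : ℕ) → g k ≈ x →
             (∀ j → j < k → g j ≈ 0#) → sumTo g k ≈ x
  sum-last g x zero    gk≈x _   = gk≈x
  sum-last g x (suc k) gk≈x g≈0 =
    trans (+-cong (sum-zero g k (λ j j≤k → g≈0 j (s≤s j≤k))) gk≈x) (+-identityˡ x)

  _≡_mod-t^_ : PS → PS → ℕ → Set ℓ
  p ≡ q mod-t^ K = ∀ k → k < K → p k ≈ q k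

  zeroPS : PS
  zeroPS _ = 0#

  shift-≡0 : ∀ K r → shiftPS K r ≡ zeroPS mod-t^ K
  shift-≡0 (suc K) r zero    _         = refl
  shift-≡0 (suc K) r (suc k) (s≤s k<K) = shift-≡0 K r k k<K

  mul-≡0 : ∀ K p q → p ≡ zeroPS mod-t^ K → mulPS p q ≡ zeroPS mod-t^ K
  mul-≡0 K p q p≡0 k k<K = sum-zero _ k λ j j≤k →
    trans (*-congʳ (p≡0 j (ℕP.≤-<-trans j≤k k<K))) (zeroˡ _)

  mul-≡1 : ∀ K p q → p ≡ onePS mod-t^ K → mulPS p q ≡ q mod-t^ K
  mul-≡1 K p q p≡1 k k<K = sum-first _ (q k) k
    (trans (*-congʳ (p≡1 0 (ℕP.≤-<-trans z≤n k<K))) (*-identityˡ (q k)))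
    (λ j j<k → trans (*-congʳ (p≡1 (suc j) (ℕP.≤-<-trans j<k k<K))) (zeroˡ _))

  pow-≡1 : ∀ K p → p ≡ onePS mod-t^ K → ∀ i → powPS p i ≡ onePS mod-t^ K
  pow-≡1 K p p≡1 zero    k k<K = refl
  pow-≡1 K p p≡1 (suc i) k k<K =
    trans (mul-≡1 K p (powPS p i) p≡1 k k<K) (pow-≡1 K p p≡1 i k k<K)

  module _ (K : ℕ) (u : PS) (u≡0 : u ≡ zeroPS mod-t^ K) where

    onePlus-≡1 : onePlus u ≡ onePS mod-t^ K
    onePlus-≡1 zero    0<K = trans (+-congˡ (u≡0 0 0<K)) (+-identityʳ 1#)
    onePlus-≡1 (suc k) k<K = u≡0 (suc k) k<K

    neg-≡0 : negPS u ≡ zeroPS mod-t^ K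
    neg-≡0 k k<K = trans (-‿cong (u≡0 k k<K)) -0#≈0#

    -- In Σ_j (-u)^j only the j = 0 term survives mod t^K.
    invOnePlus-≡1 : invOnePlus u ≡ onePS mod-t^ K
    invOnePlus-≡1 k k<K = sum-first _ (onePS k) k refl λ j _ →
      mul-≡0 K (negPS u) (powPS (negPS u) j) neg-≡0 k k<K

    wPow-≡1 : ∀ i → wPow u i ≡ onePS mod-t^ K
    wPow-≡1 (+ i)    = pow-≡1 K (onePlus u) onePlus-≡1 i
    wPow-≡1 -[1+ i ] = pow-≡1 K (invOnePlus u) invOnePlus-≡1 (suc i)

  onePS-positive : ∀ n → 0 < n → onePS n ≈ 0#
  onePS-positive (suc n) _ = refl

  -- Below v(c) both vanish; above,
  -- in Σ_{j ≤ d} c_{l+j} [t^{d-j}](1 + u)^{l+j} (l = low c, d = m - l) only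
  -- j = d contributes, with factor [t^0](1 + u)^m = 1.
  compose-coeff : ∀ K u → u ≡ zeroPS mod-t^ suc K → (c : Laurent) (m : ℤ) →
                  m ℤ.- low c ℤ.≤ + K → coeff (compose c u) m ≈ coeff c m
  compose-coeff K u u≡0 c m m-l≤K with m ℤ.<? low c
  ... | yes m<l = sym (vanish c m m<l)
  ... | no  m≮l = sum-last _ (coeff c m) d diagonal off-diagonal
    where
      l = low c
      d = ℤ.∣ m ℤ.- l ∣
      +d≡m-l : + d ≡ m ℤ.- l
      +d≡m-l = offset-natural (ℤP.≮⇒≥ m≮l)
      d≤K : d ≤ K
      d≤K = ℤP.drop‿+≤+ (P.subst (ℤ._≤ + K) (P.sym +d≡m-l) m-l≤K)
      l+d≡m : l ℤ.+ + d ≡ m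
      l+d≡m = P.trans (P.cong (λ z → l ℤ.+ z) +d≡m-l) (+-minus-cancel l m)
      power-coeff : ∀ i j → wPow u i (d ∸ j) ≈ onePS (d ∸ j)
      power-coeff i j = wPow-≡1 (suc K) u u≡0 i (d ∸ j) (s≤s (ℕP.≤-trans (ℕP.m∸n≤m d j) d≤K))
      diagonal : coeff c (l ℤ.+ + d) * wPow u (l ℤ.+ + d) (d ∸ d) ≈ coeff c m
      diagonal = trans (*-cong (reflexive (P.cong (coeff c) l+d≡m))
                               (trans (power-coeff (l ℤ.+ + d) d)
                                      (reflexive (P.cong onePS (ℕP.n∸n≡0 d)))))
                       (*-identityʳ (coeff c m))
      off-diagonal : ∀ j → j < d → coeff c (l ℤ.+ + j) * wPow u (l ℤ.+ + j) (d ∸ j) ≈ 0#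
      off-diagonal j j<d = trans (*-congˡ (trans (power-coeff (l ℤ.+ + j) j)
                                                 (onePS-positive (d ∸ j) (ℕP.m<n⇒0<n∸m j<d))))
                                 (zeroʳ _)

  -- Orb_n(c) ⊆ {x : v(x - c) > N} for n = |N - v(c)| + 2: here s = t(1 + t^{n-1} r).
  orbit-close : (c : Laurent) (N : ℕ) →
    ∃ λ (n : ℕ) → 1 < n × (∀ x → InOrb n c x → ValGt (x -L c) N)
  orbit-close c N = suc (suc K) , s≤s (s≤s z≤n) , λ x (r , x≈c∘s) m m≤N →
      trans (+-congʳ (trans (x≈c∘s m)
                            (compose-coeff K (shiftPS (suc K) r) (shift-≡0 (suc K) r) c m (m-l≤K m≤N))))
            (-‿inverseʳ (coeff c m))
    where
      K = ℤ.∣ + N ℤ.- low c ∣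
      m-l≤K : ∀ {m} → m ℤ.≤ + N → m ℤ.- low c ℤ.≤ + K
      m-l≤K m≤N = ℤP.≤-trans (ℤP.+-monoˡ-≤ (ℤ.- low c) m≤N) (i≤+∣i∣ (+ N ℤ.- low c))

mainTheorem6 : ∀ {a ℓ} (F : Field a ℓ) → Over.IsPerfect F →
    (c : Over.Laurent F) → ¬ Over.IsConstant F c → (N : ℕ) →
    ∃ λ (n : ℕ) → 1 < n ×
    (∀ x → Over.InOrb F n c x → Over.ValGt F (Over._-L_ F x c) N)
mainTheorem6 F _ c _ N = NearIdentitySubstitution.orbit-close F c N
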